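{- Let $a\in\mathbb{N}$ with $a\geq 3$, and let $S(a)$ be the submonoid of $(\mathbb{N},+)$ generated by $\{f_a+f_n\mid n\in\mathbb{N}\}$. Then \[\mathrm{Ap}(S(a),f_a)\setminus\{0\}=\left\{\#(B)\,f_a+\sum_{b\in B}f_b \;\middle|\; B\in\mathcal{F}(a)\setminus\{\emptyset\}\right\}.\] Moreover, if $B_1,B_2\in\mathcal{F}(a)\setminus\{\emptyset\}$, then $\#(B_1)f_a+\sum_{b\in B_1}f_b=\#(B_2)f_a+\sum_{b\in B_2}f_b$ if and only if $B_1=B_2$.
   Context: $\{f_n\}$ is the Fibonacci sequence ($f_0=0$, $f_1=1$, $f_{n+2}=f_{n+1}+f_n$). For a numerical semigroup $S$ and $n\in S\setminus\{0\}$, $\mathrm{Ap}(S,n)=\{s\in S\mid s-n\notin S\}$. For $m,n\in\mathbb{N}$ with $m\leq n-2$, $\mathcal{F}_n(m)$ denotes the set of subsets $X\subseteq\{2,\ldots,n-1\}$ with $\#(X)=m$ containing no two consecutive integers; and $\mathcal{F}(a)=\mathcal{F}_a(1)\cup\cdots\cup\mathcal{F}_a\left(\left\lfloor\frac{a-1}{2}\right\rfloor\right)$. $\#(A)$ denotes cardinality. -}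

module Defs where

open import Data.Nat using (ℕ; zero; suc; _+_; _*_; _∸_; _/_; _≤_)
open import Data.Bool using (Bool; true; false; if_then_else_)
open import Data.Vec using ([]; _∷_)
open import Data.Fin using (Fin; toℕ)
open import Data.Fin.Subset using (Subset; _∈_; ∣_∣)
open import Data.Product using (Σ; ∃; _×_)
open import Relation.Nullary using (¬_)
open import Relation.Binary.PropositionalEquality using (_≡_; _≢_)
open import Function using (_∘_)

fib : ℕ → ℕ
fib zero = 0
fib (suc zero) = 1
fib (suc (suc n)) = fib (suc n) + fib n

data InS (a : ℕ) : ℕ → Set where
  zeroS : InS a 0
  genS  : (n : ℕ) → InS a (fib a + fib n)
  addS  : {x y : ℕ} → InS a x → InS a y → InS a (x + y)

-- Apéry set Ap(S(a), f_a) = { s ∈ S | s - f_a ∉ S }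
-- (over ℕ: s - f_a ∈ S means s = t + f_a for some t ∈ S)
InAp : ℕ → ℕ → Set
InAp a s = InS a s × ¬ (Σ ℕ λ t → InS a t × t + fib a ≡ s)

sumSub : ∀ {n} → (ℕ → ℕ) → Subset n → ℕ
sumSub f [] = 0
sumSub f (b ∷ bs) = (if b then f 0 else 0) + sumSub (f ∘ suc) bs

InFn : (n m : ℕ) → Subset n → Set
InFn n m X =
  ∣ X ∣ ≡ m
  × (∀ (i : Fin n) → i ∈ X → 2 ≤ toℕ i)
  × (∀ (i j : Fin n) → i ∈ X → j ∈ X → toℕ j ≢ suc (toℕ i))

InF : (a : ℕ) → Subset a → Set
InF a X = Σ ℕ λ m → 1 ≤ m × m ≤ (a ∸ 1) / 2 × InFn a m X

-- Every x < fₐ is a sum of Fibonacci numbers fᵢ, 2 ≤ i < a, with no two consecutive indices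
-- (Zeckendorf), uniquely; call z(x) the number of summands. Adding one Fibonacci number raises z
-- by at most one, so the numbers m fₐ + x with x < fₐ and z(x) ≤ m are closed under adding the
-- generators fₐ + fₙ (for n ≥ a write fₐ₊ₖ = fₖ₊₁ fₐ + fₖ fₐ₋₁ to reduce to fₐ and fₐ + fₐ₋₁);
-- they are therefore exactly S(a). Hence Ap(S(a), fₐ) = { z(x) fₐ + x | x < fₐ }, and the
-- Zeckendorf sets B ∈ F(a) of the residues x parametrise these elements bijectively.
module Submission where

open import Defs
open import Data.Bool using (Bool; true; false; if_then_else_)
open import Data.Bool.Properties using (¬-not)
open import Data.Unit using (tt)
open import Data.Fin using (Fin; toℕ; fromℕ<) renaming (zero to fzero; suc to fsuc)
open import Data.Fin.Properties using (toℕ<n; toℕ-fromℕ<)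
open import Data.Fin.Subset using (Subset; _∈_; ∣_∣; ⊥)
open import Data.Fin.Subset.Properties using (∣⊥∣≡0)
open import Data.Nat.DivMod using (m*n/n≡m; /-monoˡ-≤)
open import Data.Vec.Base using ([]; _∷_; here; there)
open import Function.Bundles using (_⇔_; mk⇔)
open import Data.Nat
open import Data.Nat.Induction using (<-rec)
open import Data.Nat.Properties
open import Data.Nat.Tactic.RingSolver using (solve-∀)
open import Data.Product using (Σ; _×_; _,_; proj₂)
open import Data.Sum using (inj₁; inj₂)
open import Function using (_∘_)
open import Relation.Nullary using (¬_; yes; no; contradiction)
open import Relation.Nullary.Reflects using (ofʸ; ofⁿ)
open import Relation.Binary.PropositionalEquality

private
  variable
    k m n r : ℕ
    P Q : ℕ → Bool

fib[1+n]>0 : ∀ n → fib (suc n) > 0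
fib[1+n]>0 zero    = ≤-refl
fib[1+n]>0 (suc n) = ≤-trans (fib[1+n]>0 n) (m≤m+n _ _)

fib-≤-suc : ∀ n → fib n ≤ fib (suc n)
fib-≤-suc zero    = z≤n
fib-≤-suc (suc n) = m≤m+n _ _

fib-mono-≤ : m ≤ n → fib m ≤ fib n
fib-mono-≤ = go ∘ ≤⇒≤′
  where
  go : m ≤′ n → fib m ≤ fib n
  go ≤′-refl        = ≤-refl
  go (≤′-step {n} m≤′n) = ≤-trans (go m≤′n) (fib-≤-suc n)

n<fib[2+n] : ∀ n → n < fib (suc (suc n))
n<fib[2+n] zero    = ≤-refl
n<fib[2+n] (suc n) = ≤-trans (s≤s (n<fib[2+n] n)) (m<m+n _ (fib[1+n]>0 n))

fib-+ : ∀ m n → fib (m + suc n) ≡ fib (suc m) * fib (suc n) + fib m * fib n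
fib-+ zero          n = sym (trans (+-identityʳ (fib (suc n) + 0)) (+-identityʳ (fib (suc n))))
fib-+ (suc zero)    n = sym (cong₂ _+_ (+-identityʳ (fib (suc n))) (+-identityʳ (fib n)))
fib-+ (suc (suc m)) n = begin
  fib (suc m + suc n) + fib (m + suc n)
    ≡⟨ cong₂ _+_ (fib-+ (suc m) n) (fib-+ m n) ⟩
  (fib (suc (suc m)) * fib (suc n) + fib (suc m) * fib n) + (fib (suc m) * fib (suc n) + fib m * fib n)
    ≡⟨ regroup (fib (suc m)) (fib m) (fib (suc n)) (fib n) ⟩
  fib (suc (suc (suc m))) * fib (suc n) + fib (suc (suc m)) * fib n ∎
  where
  open ≡-Reasoning
  regroup : ∀ q r s t → ((q + r) * s + q * t) + (q * s + r * t) ≡ ((q + r) + q) * s + (q + r) * t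
  regroup = solve-∀

-- Zeckendorf length

-- Number of summands the greedy algorithm uses to write x with f₂, …, f_{n-1}.
greedyCount : ℕ → ℕ → ℕ
greedyCount zero                x = 0
greedyCount (suc zero)          x = 0
greedyCount (suc (suc zero))    x = 0
greedyCount (suc (suc (suc k))) x =
  if fib (suc (suc k)) ≤ᵇ x
  then suc (greedyCount (suc k) (x ∸ fib (suc (suc k))))
  else greedyCount (suc (suc k)) x

greedyCount-take : ∀ k x →
  greedyCount (suc (suc (suc k))) (fib (suc (suc k)) + x) ≡ suc (greedyCount (suc k) x)
greedyCount-take k x
  with fib (suc (suc k)) ≤ᵇ fib (suc (suc k)) + x | ≤ᵇ-reflects-≤ (fib (suc (suc k))) (fib (suc (suc k)) + x)
... | true  | _       = cong (suc ∘ greedyCount (suc k)) (m+n∸m≡n (fib (suc (suc k))) x)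
... | false | ofⁿ nle = contradiction (m≤m+n _ x) nle

greedyCount-skip : ∀ {k x} → x < fib (suc (suc k)) →
  greedyCount (suc (suc (suc k))) x ≡ greedyCount (suc (suc k)) x
greedyCount-skip {k} {x} x< with fib (suc (suc k)) ≤ᵇ x | ≤ᵇ-reflects-≤ (fib (suc (suc k))) x
... | true  | ofʸ le = contradiction le (<⇒≱ x<)
... | false | _      = refl

greedyCount-suc : ∀ {n x} → x < fib n → greedyCount (suc n) x ≡ greedyCount n x
greedyCount-suc {n = suc zero}    _  = refl
greedyCount-suc {n = suc (suc k)} x< = greedyCount-skip {k = k} x<

greedyCount-stable : ∀ {m n x} → m ≤ n → x < fib m → greedyCount n x ≡ greedyCount m x
greedyCount-stable {m} {n} {x} m≤n x< = go (≤⇒≤′ m≤n)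
  where
  go : m ≤′ k → greedyCount k x ≡ greedyCount m x
  go ≤′-refl            = refl
  go (≤′-step {k} m≤′k) =
    trans (greedyCount-suc {n = k} (<-≤-trans x< (fib-mono-≤ (≤′⇒≤ m≤′k)))) (go m≤′k)

-- Level x + 2 suffices since x < f_{x+2}.
summands : ℕ → ℕ
summands x = greedyCount (suc (suc x)) x

summands≡greedyCount : ∀ n {x} → x < fib n → summands x ≡ greedyCount n x
summands≡greedyCount n {x} x< with ≤-total n (suc (suc x))
... | inj₁ n≤ = greedyCount-stable n≤ x<
... | inj₂ ≤n = sym (greedyCount-stable ≤n (n<fib[2+n] x))

summands-fib+ : ∀ k → 1 ≤ k → r < fib k → summands (fib (suc k) + r) ≡ suc (summands r)
summands-fib+ {r} (suc k) _ r< = begin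
  summands (fib (suc (suc k)) + r)
    ≡⟨ summands≡greedyCount (suc (suc (suc k))) (+-monoʳ-< (fib (suc (suc k))) r<) ⟩
  greedyCount (suc (suc (suc k))) (fib (suc (suc k)) + r)
    ≡⟨ greedyCount-take k r ⟩
  suc (greedyCount (suc k) r)
    ≡⟨ cong suc (summands≡greedyCount (suc k) r<) ⟨
  suc (summands r) ∎
  where open ≡-Reasoning

summands-fib : ∀ n → summands (fib n) ≤ 1
summands-fib zero                = z≤n
summands-fib (suc zero)          = summands-fib 2
summands-fib (suc (suc n)) = ≤-reflexive (begin
  summands (fib (suc (suc n)))     ≡⟨ cong summands (+-identityʳ (fib (suc (suc n)))) ⟨
  summands (fib (suc (suc n)) + 0) ≡⟨ summands-fib+ (suc n) (s≤s z≤n) (fib[1+n]>0 n) ⟩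
  1                                ∎)
  where open ≡-Reasoning

∸-<-cancelˡ : ∀ m {n o} → n < m + o → m ≤ n → n ∸ m < o
∸-<-cancelˡ m {n} {o} n< m≤n = subst (n ∸ m <_) (m+n∸m≡n m o) (∸-monoˡ-< n< m≤n)

data LeadingFib : ℕ → Set where
  zero : LeadingFib 0
  lead : ∀ j {r} → r < fib (suc j) → LeadingFib (fib (suc (suc j)) + r)

leadingFib : ∀ x → LeadingFib x
leadingFib x = below x (n<fib[2+n] x)
  where
  below : ∀ m {x} → x < fib (suc (suc m)) → LeadingFib x
  below zero    (s≤s z≤n) = zero
  below (suc m) {x} x< with fib (suc (suc m)) ≤? x
  ... | yes le = subst LeadingFib (m+[n∸m]≡n le) (lead m (∸-<-cancelˡ (fib (suc (suc m))) x< le))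
  ... | no  nle = below m (≰⇒> nle)

module LeadingTerm (j : ℕ) {r : ℕ} (r< : r < fib (suc j))
                   (ih : ∀ n → summands (r + fib n) ≤ suc (summands r)) where

  x : ℕ
  x = fib (suc (suc j)) + r

  private
    A B C : ℕ
    A = fib (suc (suc j))
    B = fib (suc j)
    C = fib j

  summands-x : summands x ≡ suc (summands r)
  summands-x = summands-fib+ (suc j) (s≤s z≤n) r<

  +fib-near : 2 ≤ n → n ≤ j → summands (x + fib n) ≤ suc (summands x)
  +fib-near {n} 2≤n n≤j with r + fib n <? B
  ... | yes u< = begin
    summands (A + r + fib n)   ≡⟨ cong summands (+-assoc A r (fib n)) ⟩
    summands (A + (r + fib n)) ≡⟨ summands-fib+ (suc j) (s≤s z≤n) u< ⟩
    suc (summands (r + fib n)) ≤⟨ s≤s (ih n) ⟩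
    suc (suc (summands r))     ≡⟨ cong suc summands-x ⟨
    suc (summands x)           ∎
    where open ≤-Reasoning
  ... | no u≮ = begin
    summands (A + r + fib n) ≡⟨ cong summands carry ⟩
    summands (A + B + v)     ≡⟨ summands-fib+ (suc (suc j)) (s≤s z≤n) (<-≤-trans v< C≤A) ⟩
    suc (summands v)         ≡⟨ summands-fib+ j (≤-trans (s≤s z≤n) (≤-trans 2≤n n≤j)) v< ⟨
    summands (B + v)         ≡⟨ cong summands (m+[n∸m]≡n B≤u) ⟩
    summands (r + fib n)     ≤⟨ ih n ⟩
    suc (summands r)         ≡⟨ summands-x ⟨
    summands x               ≤⟨ n≤1+n _ ⟩
    suc (summands x)         ∎
    where
    open ≤-Reasoning
    B≤u : B ≤ r + fib n
    B≤u = ≮⇒≥ u≮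
    v : ℕ
    v = r + fib n ∸ B
    v< : v < C
    v< = ∸-<-cancelˡ B (+-mono-<-≤ r< (fib-mono-≤ n≤j)) B≤u
    C≤A : C ≤ A
    C≤A = fib-mono-≤ (m≤n+m j 2)
    carry : A + r + fib n ≡ A + B + v
    carry = begin-equality
      A + r + fib n   ≡⟨ +-assoc A r (fib n) ⟩
      A + (r + fib n) ≡⟨ cong (A +_) (m+[n∸m]≡n B≤u) ⟨
      A + (B + v)     ≡⟨ +-assoc A B v ⟨
      A + B + v       ∎

  +fib[1+j] : summands (x + fib (suc j)) ≡ summands x
  +fib[1+j] = begin
    summands (A + r + B) ≡⟨ cong summands (swap A r B) ⟩
    summands (A + B + r) ≡⟨ summands-fib+ (suc (suc j)) (s≤s z≤n) (<-≤-trans r< (fib-≤-suc (suc j))) ⟩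
    suc (summands r)     ≡⟨ summands-x ⟨
    summands x           ∎
    where
    open ≡-Reasoning
    swap : ∀ a r b → a + r + b ≡ a + b + r
    swap = solve-∀

  +fib[2+j] : summands (x + fib (suc (suc j))) ≤ suc (summands x)
  +fib[2+j] = begin
    summands (A + r + A)       ≡⟨ cong summands (double B C r) ⟩
    summands (A + B + (r + C)) ≡⟨ summands-fib+ (suc (suc j)) (s≤s z≤n) (+-monoˡ-< C r<) ⟩
    suc (summands (r + C))     ≤⟨ s≤s (ih j) ⟩
    suc (suc (summands r))     ≡⟨ cong suc summands-x ⟨
    suc (summands x)           ∎
    where
    open ≤-Reasoning
    double : ∀ b c r → b + c + r + (b + c) ≡ b + c + b + (r + c)
    double = solve-∀

  +fib[3+j] : summands (x + fib (suc (suc (suc j)))) ≡ summands x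
  +fib[3+j] = begin
    summands (A + r + (A + B)) ≡⟨ cong summands (swap A r B) ⟩
    summands (A + B + A + r)   ≡⟨ summands-fib+ (suc (suc (suc j))) (s≤s z≤n) r<fib[3+j] ⟩
    suc (summands r)           ≡⟨ summands-x ⟨
    summands x                 ∎
    where
    open ≡-Reasoning
    swap : ∀ a r b → a + r + (a + b) ≡ a + b + a + r
    swap = solve-∀
    r<fib[3+j] : r < fib (suc (suc (suc j)))
    r<fib[3+j] = <-≤-trans r< (fib-mono-≤ (m≤n+m (suc j) 2))

  +fib-far : suc (suc (suc (suc j))) ≤ n → summands (x + fib n) ≡ suc (summands x)
  +fib-far {suc k} (s≤s j+3≤k) = trans (cong summands (+-comm x (fib (suc k))))
    (summands-fib+ k (≤-trans (s≤s z≤n) j+3≤k) (<-≤-trans (+-monoʳ-< A r<) (fib-mono-≤ j+3≤k)))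

  +fib-beyond : suc j ≤′ n → summands (x + fib n) ≤ suc (summands x)
  +fib-beyond ≤′-refl                              = m≤n⇒m≤1+n (≤-reflexive +fib[1+j])
  +fib-beyond (≤′-step ≤′-refl)                    = +fib[2+j]
  +fib-beyond (≤′-step (≤′-step ≤′-refl))          = m≤n⇒m≤1+n (≤-reflexive +fib[3+j])
  +fib-beyond (≤′-step (≤′-step (≤′-step j<′n))) = ≤-reflexive (+fib-far (s≤s (s≤s (s≤s (≤′⇒≤ j<′n)))))

  summands-+fib : ∀ n → 2 ≤ n → summands (x + fib n) ≤ suc (summands x)
  summands-+fib n 2≤n with n ≤? j
  ... | yes n≤j = +fib-near 2≤n n≤j
  ... | no  n≰j = +fib-beyond (≤⇒≤′ (≰⇒> n≰j))

-- Induction on x = f_{j+2} + r, comparing n with j; a collision with the leading term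
-- carries upwards via f_{j+2} + f_{j+1} = f_{j+3} and 2 f_{j+2} = f_{j+3} + f_j.
summands-+fib : ∀ x n → summands (x + fib n) ≤ suc (summands x)
summands-+fib = <-rec (λ x → ∀ n → summands (x + fib n) ≤ suc (summands x)) step
  where
  step : ∀ x → (∀ {y} → y < x → ∀ n → summands (y + fib n) ≤ suc (summands y)) →
         ∀ n → summands (x + fib n) ≤ suc (summands x)
  step x _  zero          = subst (λ y → summands y ≤ suc (summands x)) (sym (+-identityʳ x)) (n≤1+n _)
  step x ih (suc zero)    = step x ih 2  -- f₁ = f₂
  step x ih (suc (suc n)) with leadingFib x
  ... | zero = ≤-trans (summands-fib (suc (suc n))) (s≤s z≤n)
  ... | lead j {r} r< =
    LeadingTerm.summands-+fib j r< (ih (m<n+m r (fib[1+n]>0 (suc j)))) (suc (suc n)) (s≤s (s≤s z≤n))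

-- Zeckendorf representations

sumBelow : (ℕ → ℕ) → ℕ → (ℕ → Bool) → ℕ
sumBelow f zero    P = 0
sumBelow f (suc n) P = sumBelow f n P + (if P n then f n else 0)

countBelow : ℕ → (ℕ → Bool) → ℕ
countBelow = sumBelow (λ _ → 1)

sumBelow-cong : ∀ f n → (∀ i → i < n → P i ≡ Q i) → sumBelow f n P ≡ sumBelow f n Q
sumBelow-cong f zero    _  = refl
sumBelow-cong f (suc n) eq = cong₂ (λ s b → s + (if b then f n else 0))
  (sumBelow-cong f n (λ i i<n → eq i (m<n⇒m<1+n i<n))) (eq n ≤-refl)

sumBelow-absent : ∀ f n P → P n ≡ false → sumBelow f (suc n) P ≡ sumBelow f n P
sumBelow-absent f n P e rewrite e = +-identityʳ (sumBelow f n P)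

sumBelow-present : ∀ f k P → P (suc (suc k)) ≡ true → P (suc k) ≡ false →
                   sumBelow f (suc (suc (suc k))) P ≡ sumBelow f (suc k) P + f (suc (suc k))
sumBelow-present f k P t e rewrite t | e = cong (_+ f (suc (suc k))) (+-identityʳ (sumBelow f (suc k) P))

record IsZeckendorf (n : ℕ) (P : ℕ → Bool) : Set where
  field
    ≥2             : ∀ i → i < n → P i ≡ true → 2 ≤ i
    nonconsecutive : ∀ i → suc i < n → P i ≡ true → P (suc i) ≡ false

open IsZeckendorf

IsZeckendorf-∅ : IsZeckendorf n (λ _ → false)
IsZeckendorf-∅ = record { ≥2 = λ _ _ () ; nonconsecutive = λ _ _ () }

IsZeckendorf-restrict : m ≤ n → (∀ i → i < m → Q i ≡ P i) → IsZeckendorf n P → IsZeckendorf m Q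
IsZeckendorf-restrict m≤n eq z = record
  { ≥2             = λ i i<m qi → ≥2 z i (<-≤-trans i<m m≤n) (trans (sym (eq i i<m)) qi)
  ; nonconsecutive = λ i i+1<m qi → trans (eq (suc i) i+1<m)
      (nonconsecutive z i (<-≤-trans i+1<m m≤n) (trans (sym (eq i (<-trans (n<1+n i) i+1<m))) qi))
  }

IsZeckendorf-≤ : m ≤ n → IsZeckendorf n P → IsZeckendorf m P
IsZeckendorf-≤ m≤n = IsZeckendorf-restrict m≤n (λ _ _ → refl)

IsZeckendorf-extend : IsZeckendorf n P → (P n ≡ true → 2 ≤ n) →
                      (∀ i → suc i ≡ n → P i ≡ true → P n ≡ false) → IsZeckendorf (suc n) P
IsZeckendorf-extend {n} {P} z top≥2 top-isolated = record { ≥2 = ≥2′ ; nonconsecutive = nonconsecutive′ }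
  where
  ≥2′ : ∀ i → i < suc n → P i ≡ true → 2 ≤ i
  ≥2′ i i< pi with m<1+n⇒m<n∨m≡n i<
  ... | inj₁ i<n  = ≥2 z i i<n pi
  ... | inj₂ refl = top≥2 pi
  nonconsecutive′ : ∀ i → suc i < suc n → P i ≡ true → P (suc i) ≡ false
  nonconsecutive′ i i+1< pi with m<1+n⇒m<n∨m≡n i+1<
  ... | inj₁ i+1<n = nonconsecutive z i i+1<n pi
  ... | inj₂ refl  = top-isolated i refl pi

IsZeckendorf-absent : IsZeckendorf n P → P n ≡ false → IsZeckendorf (suc n) P
IsZeckendorf-absent z e = IsZeckendorf-extend z (λ t → contradiction (trans (sym t) e) λ ()) (λ _ _ _ → e)

data TopView : ℕ → (ℕ → Bool) → Set where
  absent  : ∀ {n P} → P n ≡ false → TopView (suc n) P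
  present : ∀ {k P} → P (suc (suc k)) ≡ true → P (suc k) ≡ false → TopView (suc (suc (suc k))) P

topView : ∀ n → IsZeckendorf (suc n) P → TopView (suc n) P
topView {P} n z with P n in e
... | false = absent e
... | true with n
...   | zero        = contradiction (≥2 z 0 ≤-refl e) λ ()
...   | suc zero    = contradiction (≥2 z 1 ≤-refl e) λ { (s≤s ()) }
...   | suc (suc k) with P (suc k) in e′
...     | false = present e e′
...     | true  = contradiction (trans (sym e) (nonconsecutive z (suc k) ≤-refl e′)) λ ()

sumBelow-fib-< : ∀ n → IsZeckendorf (suc n) P → sumBelow fib (suc n) P < fib (suc n)
sumBelow-fib-< {P} n z with topView n z
... | absent {zero} e = subst (_< 1) (sym (sumBelow-absent fib 0 P e)) ≤-refl
... | absent {suc m} e = begin-strict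
  sumBelow fib (suc (suc m)) P ≡⟨ sumBelow-absent fib (suc m) P e ⟩
  sumBelow fib (suc m) P       <⟨ sumBelow-fib-< m (IsZeckendorf-≤ (n≤1+n _) z) ⟩
  fib (suc m)                  ≤⟨ fib-≤-suc (suc m) ⟩
  fib (suc (suc m))            ∎
  where open ≤-Reasoning
... | present {k} t e = begin-strict
  sumBelow fib (suc (suc (suc k))) P          ≡⟨ sumBelow-present fib k P t e ⟩
  sumBelow fib (suc k) P + fib (suc (suc k))
    <⟨ +-monoˡ-< _ (sumBelow-fib-< k (IsZeckendorf-≤ (m≤n+m _ 2) z)) ⟩
  fib (suc k) + fib (suc (suc k))             ≡⟨ +-comm (fib (suc k)) _ ⟩
  fib (suc (suc (suc k)))                     ∎
  where open ≤-Reasoning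

countBelow≡greedyCount : ∀ n → IsZeckendorf n P → countBelow n P ≡ greedyCount n (sumBelow fib n P)
countBelow≡greedyCount         zero    _ = refl
countBelow≡greedyCount {P} (suc n) z with topView n z
... | absent {zero} e = sumBelow-absent (λ _ → 1) 0 P e
... | absent {suc m} e = begin
  countBelow (suc (suc m)) P
    ≡⟨ sumBelow-absent (λ _ → 1) (suc m) P e ⟩
  countBelow (suc m) P
    ≡⟨ countBelow≡greedyCount (suc m) z′ ⟩
  greedyCount (suc m) (sumBelow fib (suc m) P)
    ≡⟨ greedyCount-suc {n = suc m} (sumBelow-fib-< m z′) ⟨
  greedyCount (suc (suc m)) (sumBelow fib (suc m) P)
    ≡⟨ cong (greedyCount (suc (suc m))) (sumBelow-absent fib (suc m) P e) ⟨
  greedyCount (suc (suc m)) (sumBelow fib (suc (suc m)) P) ∎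
  where
  open ≡-Reasoning
  z′ : IsZeckendorf (suc m) P
  z′ = IsZeckendorf-≤ (n≤1+n _) z
... | present {k} t e = begin
  countBelow (suc (suc (suc k))) P
    ≡⟨ sumBelow-present (λ _ → 1) k P t e ⟩
  countBelow (suc k) P + 1
    ≡⟨ +-comm _ 1 ⟩
  suc (countBelow (suc k) P)
    ≡⟨ cong suc (countBelow≡greedyCount (suc k) z′) ⟩
  suc (greedyCount (suc k) (sumBelow fib (suc k) P))
    ≡⟨ greedyCount-take k (sumBelow fib (suc k) P) ⟨
  greedyCount (suc (suc (suc k))) (fib (suc (suc k)) + sumBelow fib (suc k) P)
    ≡⟨ cong (greedyCount (suc (suc (suc k)))) (+-comm (fib (suc (suc k))) _) ⟩
  greedyCount (suc (suc (suc k))) (sumBelow fib (suc k) P + fib (suc (suc k)))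
    ≡⟨ cong (greedyCount (suc (suc (suc k)))) (sumBelow-present fib k P t e) ⟨
  greedyCount (suc (suc (suc k))) (sumBelow fib (suc (suc (suc k))) P) ∎
  where
  open ≡-Reasoning
  z′ : IsZeckendorf (suc k) P
  z′ = IsZeckendorf-≤ (m≤n+m _ 2) z

countBelow≡summands : ∀ n → IsZeckendorf (suc n) P →
                      countBelow (suc n) P ≡ summands (sumBelow fib (suc n) P)
countBelow≡summands n z =
  trans (countBelow≡greedyCount (suc n) z) (sym (summands≡greedyCount (suc n) (sumBelow-fib-< n z)))

countBelow*2≤ : ∀ n → IsZeckendorf n P → countBelow n P * 2 ≤ n ∸ 1
countBelow*2≤     zero    _ = z≤n
countBelow*2≤ {P} (suc n) z with topView n z
... | absent e = begin
  countBelow (suc n) P * 2 ≡⟨ cong (_* 2) (sumBelow-absent (λ _ → 1) n P e) ⟩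
  countBelow n P * 2       ≤⟨ countBelow*2≤ n (IsZeckendorf-≤ (n≤1+n n) z) ⟩
  n ∸ 1                    ≤⟨ m∸n≤m n 1 ⟩
  n                        ∎
  where open ≤-Reasoning
... | present {k} t e = begin
  countBelow (suc (suc (suc k))) P * 2 ≡⟨ cong (_* 2) (sumBelow-present (λ _ → 1) k P t e) ⟩
  (countBelow (suc k) P + 1) * 2       ≡⟨ *-distribʳ-+ 2 (countBelow (suc k) P) 1 ⟩
  countBelow (suc k) P * 2 + 2
    ≤⟨ +-monoˡ-≤ 2 (countBelow*2≤ (suc k) (IsZeckendorf-≤ (m≤n+m _ 2) z)) ⟩
  k + 2                                ≡⟨ +-comm k 2 ⟩
  suc (suc k)                          ∎
  where open ≤-Reasoning

absent<present : IsZeckendorf (suc (suc (suc k))) P → P (suc (suc k)) ≡ false →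
                 Q (suc (suc k)) ≡ true → Q (suc k) ≡ false →
                 sumBelow fib (suc (suc (suc k))) P < sumBelow fib (suc (suc (suc k))) Q
absent<present {k} {P} {Q} z e t e′ = begin-strict
  sumBelow fib (suc (suc (suc k))) P         ≡⟨ sumBelow-absent fib _ P e ⟩
  sumBelow fib (suc (suc k)) P               <⟨ sumBelow-fib-< (suc k) (IsZeckendorf-≤ (n≤1+n _) z) ⟩
  fib (suc (suc k))                          ≤⟨ m≤n+m _ (sumBelow fib (suc k) Q) ⟩
  sumBelow fib (suc k) Q + fib (suc (suc k)) ≡⟨ sumBelow-present fib k Q t e′ ⟨
  sumBelow fib (suc (suc (suc k))) Q         ∎
  where open ≤-Reasoning

top-unique : ∀ n → IsZeckendorf (suc n) P → IsZeckendorf (suc n) Q →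
             sumBelow fib (suc n) P ≡ sumBelow fib (suc n) Q → P n ≡ Q n
top-unique n zP zQ eq with topView n zP | topView n zQ
... | absent e    | absent e′   = trans e (sym e′)
... | present t _ | present t′ _ = trans t (sym t′)
... | absent e    | present t e′ = contradiction eq (<⇒≢ (absent<present zP e t e′))
... | present t e | absent e′    = contradiction (sym eq) (<⇒≢ (absent<present zQ e′ t e))

zeckendorf-unique : ∀ n → IsZeckendorf n P → IsZeckendorf n Q →
                    sumBelow fib n P ≡ sumBelow fib n Q → ∀ i → i < n → P i ≡ Q i
zeckendorf-unique {P} {Q} (suc n) zP zQ eq i i< with m<1+n⇒m<n∨m≡n i<
... | inj₂ refl = top-unique n zP zQ eq
... | inj₁ i<n  = zeckendorf-unique n (IsZeckendorf-≤ (n≤1+n n) zP) (IsZeckendorf-≤ (n≤1+n n) zQ)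
    (+-cancelʳ-≡ _ _ _ (trans eq (cong (λ b → sumBelow fib n Q + (if b then fib n else 0))
      (sym (top-unique n zP zQ eq))))) i i<n

_[_]≔_ : (ℕ → Bool) → ℕ → Bool → ℕ → Bool
(P [ k ]≔ b) i = if i ≡ᵇ k then b else P i

[]≔-same : ∀ P k b → (P [ k ]≔ b) k ≡ b
[]≔-same P k b with k ≡ᵇ k | ≡⇒≡ᵇ k k refl
... | true | _ = refl

[]≔-< : ∀ P {k i} b → i < k → (P [ k ]≔ b) i ≡ P i
[]≔-< P {k} {i} b i<k with i ≡ᵇ k | ≡ᵇ⇒≡ i k
... | false | _     = refl
... | true  | i≡k = contradiction (i≡k tt) (<⇒≢ i<k)

ZeckendorfRep : ℕ → ℕ → Set
ZeckendorfRep n x = Σ (ℕ → Bool) λ P → IsZeckendorf n P × sumBelow fib n P ≡ x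

zeckendorf-extend-absent : ∀ n → IsZeckendorf n P → ZeckendorfRep (suc n) (sumBelow fib n P)
zeckendorf-extend-absent {P} n z =
  P′ , zP′ , trans (sumBelow-absent fib n P′ P′[n]) (sumBelow-cong fib n P′≡P)
  where
  P′ : ℕ → Bool
  P′ = P [ n ]≔ false
  P′≡P : ∀ i → i < n → P′ i ≡ P i
  P′≡P i = []≔-< P false
  P′[n] : P′ n ≡ false
  P′[n] = []≔-same P n false
  zP′ : IsZeckendorf (suc n) P′
  zP′ = IsZeckendorf-absent (IsZeckendorf-restrict ≤-refl P′≡P z) P′[n]

zeckendorf-extend-present : ∀ k → IsZeckendorf (suc k) P →
                            ZeckendorfRep (suc (suc (suc k))) (sumBelow fib (suc k) P + fib (suc (suc k)))
zeckendorf-extend-present {P} k z =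
  P′ , zP′ , trans (sumBelow-present fib k P′ P′[2+k] P′[1+k])
                   (cong (_+ fib (suc (suc k))) (sumBelow-cong fib (suc k) P′≡P))
  where
  P′ : ℕ → Bool
  P′ = (P [ suc k ]≔ false) [ suc (suc k) ]≔ true
  P′≡P : ∀ i → i < suc k → P′ i ≡ P i
  P′≡P i i< = trans ([]≔-< (P [ suc k ]≔ false) true (<-trans i< (n<1+n _))) ([]≔-< P false i<)
  P′[1+k] : P′ (suc k) ≡ false
  P′[1+k] = trans ([]≔-< (P [ suc k ]≔ false) true ≤-refl) ([]≔-same P (suc k) false)
  P′[2+k] : P′ (suc (suc k)) ≡ true
  P′[2+k] = []≔-same (P [ suc k ]≔ false) (suc (suc k)) true
  zP′ : IsZeckendorf (suc (suc (suc k))) P′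
  zP′ = IsZeckendorf-extend
         (IsZeckendorf-absent (IsZeckendorf-restrict ≤-refl P′≡P z) P′[1+k])
         (λ _ → s≤s (s≤s z≤n))
         (λ { _ refl t → contradiction (trans (sym t) P′[1+k]) λ () })

zeckendorf-exists-step : ∀ k {x} → x < fib (suc (suc (suc k))) →
                         (∀ {v} → v < fib (suc k) → ZeckendorfRep (suc k) v) →
                         (x < fib (suc (suc k)) → ZeckendorfRep (suc (suc k)) x) →
                         ZeckendorfRep (suc (suc (suc k))) x
zeckendorf-exists-step k {x} x< rep₁ rep₂ with fib (suc (suc k)) ≤? x
... | yes le with rep₁ (∸-<-cancelˡ (fib (suc (suc k))) x< le)
...   | P , zP , sumP with zeckendorf-extend-present k zP
...     | Q , zQ , sumQ = Q , zQ , trans sumQ (trans (cong (_+ fib (suc (suc k))) sumP) (m∸n+n≡m le))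
zeckendorf-exists-step k x< rep₁ rep₂ | no nle with rep₂ (≰⇒> nle)
...   | P , zP , sumP with zeckendorf-extend-absent (suc (suc k)) zP
...     | Q , zQ , sumQ = Q , zQ , trans sumQ sumP

zeckendorf-exists : ∀ n {x} → x < fib n → ZeckendorfRep n x
zeckendorf-exists (suc zero)          {zero}  _         = (λ _ → false) , IsZeckendorf-∅ , refl
zeckendorf-exists (suc (suc zero))    {zero}  _         = (λ _ → false) , IsZeckendorf-∅ , refl
zeckendorf-exists (suc zero)          {suc _} (s≤s ())
zeckendorf-exists (suc (suc zero))    {suc _} (s≤s ())
zeckendorf-exists (suc (suc (suc k)))         x<        =
  zeckendorf-exists-step k x< (zeckendorf-exists (suc k)) (zeckendorf-exists (suc (suc k)))

indicator : ∀ {n} → Subset n → ℕ → Bool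
indicator []      _       = false
indicator (b ∷ _) zero    = b
indicator (_ ∷ B) (suc i) = indicator B i

fromIndicator : ∀ n → (ℕ → Bool) → Subset n
fromIndicator zero    P = []
fromIndicator (suc n) P = P 0 ∷ fromIndicator n (P ∘ suc)

indicator-fromIndicator : ∀ n P i → i < n → indicator (fromIndicator n P) i ≡ P i
indicator-fromIndicator (suc n) P zero    _         = refl
indicator-fromIndicator (suc n) P (suc i) (s≤s i<n) = indicator-fromIndicator n (P ∘ suc) i i<n

indicator-injective : ∀ {n} (B C : Subset n) → (∀ i → i < n → indicator B i ≡ indicator C i) → B ≡ C
indicator-injective []      []      _  = refl
indicator-injective (b ∷ B) (c ∷ C) eq =
  cong₂ _∷_ (eq 0 z<s) (indicator-injective B C (λ i i<n → eq (suc i) (s<s i<n)))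

∈⇒indicator : ∀ {n} {B : Subset n} {i : Fin n} → i ∈ B → indicator B (toℕ i) ≡ true
∈⇒indicator here        = refl
∈⇒indicator (there i∈B) = ∈⇒indicator i∈B

indicator⇒∈ : ∀ {n} (B : Subset n) (i : Fin n) → indicator B (toℕ i) ≡ true → i ∈ B
indicator⇒∈ (true ∷ B) fzero    refl = here
indicator⇒∈ (_    ∷ B) (fsuc i) e    = there (indicator⇒∈ B i e)

sumBelow-suc : ∀ f n P → sumBelow f (suc n) P ≡ (if P 0 then f 0 else 0) + sumBelow (f ∘ suc) n (P ∘ suc)
sumBelow-suc f zero    P = sym (+-identityʳ _)
sumBelow-suc f (suc n) P = trans (cong (_+ (if P (suc n) then f (suc n) else 0)) (sumBelow-suc f n P))
                                 (+-assoc (if P 0 then f 0 else 0) _ _)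

sumSub≡sumBelow : ∀ f {n} (B : Subset n) → sumSub f B ≡ sumBelow f n (indicator B)
sumSub≡sumBelow f         []      = refl
sumSub≡sumBelow f {suc n} (b ∷ B) =
  trans (cong ((if b then f 0 else 0) +_) (sumSub≡sumBelow (f ∘ suc) B))
        (sym (sumBelow-suc f n (indicator (b ∷ B))))

∣∣≡countBelow : ∀ {n} (B : Subset n) → ∣ B ∣ ≡ countBelow n (indicator B)
∣∣≡countBelow         []          = refl
∣∣≡countBelow {suc n} (true  ∷ B) =
  trans (cong suc (∣∣≡countBelow B)) (sym (sumBelow-suc _ n (indicator (true ∷ B))))
∣∣≡countBelow {suc n} (false ∷ B) =
  trans (∣∣≡countBelow B) (sym (sumBelow-suc _ n (indicator (false ∷ B))))

∣p∣≡0⇒p≡⊥ : ∀ {n} (p : Subset n) → ∣ p ∣ ≡ 0 → p ≡ ⊥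
∣p∣≡0⇒p≡⊥ []          _ = refl
∣p∣≡0⇒p≡⊥ (false ∷ p) e = cong (false ∷_) (∣p∣≡0⇒p≡⊥ p e)

InF⇒IsZeckendorf : ∀ {a} {B : Subset a} → InF a B → IsZeckendorf a (indicator B)
InF⇒IsZeckendorf {a} {B} (_ , _ , _ , _ , ∈⇒≥2 , ∈⇒nonconsecutive) = record
  { ≥2             = λ i i<a Bi → subst (2 ≤_) (toℕ-fromℕ< i<a) (∈⇒≥2 (fromℕ< i<a) (member i<a Bi))
  ; nonconsecutive = λ i i+1<a Bi → let i<a = <-trans (n<1+n i) i+1<a in ¬-not λ Bi+1 →
      ∈⇒nonconsecutive (fromℕ< i<a) (fromℕ< i+1<a) (member i<a Bi) (member i+1<a Bi+1)
        (trans (toℕ-fromℕ< i+1<a) (cong suc (sym (toℕ-fromℕ< i<a))))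
  }
  where
  member : ∀ {i} (i<a : i < a) → indicator B i ≡ true → fromℕ< i<a ∈ B
  member i<a Bi = indicator⇒∈ B _ (trans (cong (indicator B) (toℕ-fromℕ< i<a)) Bi)

IsZeckendorf⇒InF : ∀ {a} {B : Subset a} → IsZeckendorf a (indicator B) → B ≢ ⊥ → InF a B
IsZeckendorf⇒InF {a} {B} z B≢⊥ = ∣ B ∣ , 1≤∣B∣ , ∣B∣≤ , refl , ∈⇒≥2 , ∈⇒nonconsecutive
  where
  1≤∣B∣ : 1 ≤ ∣ B ∣
  1≤∣B∣ = n≢0⇒n>0 (B≢⊥ ∘ ∣p∣≡0⇒p≡⊥ B)
  ∣B∣≤ : ∣ B ∣ ≤ (a ∸ 1) / 2
  ∣B∣≤ = subst (_≤ (a ∸ 1) / 2) (m*n/n≡m ∣ B ∣ 2)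
           (/-monoˡ-≤ 2 (subst (λ c → c * 2 ≤ a ∸ 1) (sym (∣∣≡countBelow B)) (countBelow*2≤ a z)))
  ∈⇒≥2 : ∀ (i : Fin a) → i ∈ B → 2 ≤ toℕ i
  ∈⇒≥2 i i∈B = ≥2 z (toℕ i) (toℕ<n i) (∈⇒indicator i∈B)
  ∈⇒nonconsecutive : ∀ (i j : Fin a) → i ∈ B → j ∈ B → toℕ j ≢ suc (toℕ i)
  ∈⇒nonconsecutive i j i∈B j∈B j≡i+1 = contradiction
    (trans (sym (subst (λ k → indicator B k ≡ true) j≡i+1 (∈⇒indicator j∈B)))
           (nonconsecutive z (toℕ i) (subst (_< a) j≡i+1 (toℕ<n j)) (∈⇒indicator i∈B)))
    λ ()

-- The semigroup S(a) and its Apéry set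

+*-closed : ∀ {A : ℕ → Set} g → (∀ {s} → A s → A (s + g)) → ∀ q {s} → A s → A (s + q * g)
+*-closed {A} g step zero    {s} t = subst A (sym (+-identityʳ s)) t
+*-closed {A} g step (suc q) {s} t = subst A (+-assoc s g (q * g)) (+*-closed {A} g step q (step t))

quot-rem-unique : ∀ {d m n x y} → x < d → y < d → m * d + x ≡ n * d + y → m ≡ n × x ≡ y
quot-rem-unique {m = zero}  {zero}  _  _  eq = refl , eq
quot-rem-unique {d} {suc m} {suc n} {x} {y} x< y< eq
  with quot-rem-unique {m = m} {n} x< y<
         (+-cancelˡ-≡ d _ _ (trans (sym (+-assoc d (m * d) x)) (trans eq (+-assoc d (n * d) y))))
... | m≡n , x≡y = cong suc m≡n , x≡y
quot-rem-unique {d} {zero}  {suc n} {x} {y} x< _  eq =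
  contradiction (subst (d ≤_) (sym eq) (≤-trans (m≤m+n d (n * d)) (m≤m+n _ y))) (<⇒≱ x<)
quot-rem-unique {d} {suc m} {zero}  {x} {y} _  y< eq =
  contradiction (subst (d ≤_) eq (≤-trans (m≤m+n d (m * d)) (m≤m+n _ x))) (<⇒≱ y<)

data NormalForm (a : ℕ) : ℕ → Set where
  normal : ∀ m {x} → x < fib a → summands x ≤ m → NormalForm a (m * fib a + x)

NormalForm-+fₐ : ∀ {a s} → NormalForm a s → NormalForm a (s + fib a)
NormalForm-+fₐ {a} (normal m {x} x< x≤m) =
  subst (NormalForm a) (shift m (fib a) x) (normal (suc m) x< (m≤n⇒m≤1+n x≤m))
  where
  shift : ∀ m F x → suc m * F + x ≡ m * F + x + F
  shift = solve-∀

NormalForm-+fib : ∀ {a s n} → 2 ≤ a → n < a → NormalForm a s → NormalForm a (s + (fib a + fib n))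
NormalForm-+fib {suc b} {_} {n} (s≤s 1≤b) n<a (normal m {x} x< x≤m) with x + fib n <? fib (suc b)
... | yes y< = subst (NormalForm (suc b)) (shift m (fib (suc b)) x (fib n))
                 (normal (suc m) y< (≤-trans (summands-+fib x n) (s≤s x≤m)))
  where
  shift : ∀ m F x f → suc m * F + (x + f) ≡ m * F + x + (F + f)
  shift = solve-∀
... | no y≮ = subst (NormalForm (suc b)) carry (normal (suc (suc m)) y′<F y′≤m+2)
  where
  F : ℕ
  F = fib (suc b)
  F≤y : F ≤ x + fib n
  F≤y = ≮⇒≥ y≮
  y′ : ℕ
  y′ = x + fib n ∸ F
  y′< : y′ < fib b
  y′< = ∸-<-cancelˡ F (+-mono-<-≤ x< (fib-mono-≤ (s≤s⁻¹ n<a))) F≤y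
  y′<F : y′ < F
  y′<F = <-≤-trans y′< (fib-≤-suc b)
  y′≤m+2 : summands y′ ≤ suc (suc m)
  y′≤m+2 = ≤-trans (s≤s⁻¹ (begin
    suc (summands y′)      ≡⟨ summands-fib+ b 1≤b y′< ⟨
    summands (F + y′)      ≡⟨ cong summands (m+[n∸m]≡n F≤y) ⟩
    summands (x + fib n)   ≤⟨ summands-+fib x n ⟩
    suc (summands x)       ≤⟨ s≤s x≤m ⟩
    suc m                  ∎)) (≤-trans (n≤1+n m) (n≤1+n (suc m)))
    where open ≤-Reasoning
  carry : suc (suc m) * F + y′ ≡ m * F + x + (F + fib n)
  carry = begin
    suc (suc m) * F + y′   ≡⟨ regroup₁ m F y′ ⟩
    m * F + F + (F + y′)   ≡⟨ cong (m * F + F +_) (m+[n∸m]≡n F≤y) ⟩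
    m * F + F + (x + fib n) ≡⟨ regroup₂ m F x (fib n) ⟩
    m * F + x + (F + fib n) ∎
    where
    open ≡-Reasoning
    regroup₁ : ∀ m F y → suc (suc m) * F + y ≡ m * F + F + (F + y)
    regroup₁ = solve-∀
    regroup₂ : ∀ m F x f → m * F + F + (x + f) ≡ m * F + x + (F + f)
    regroup₂ = solve-∀

-- Addition formula: fₐ + f_{k+1+a} = (1 + fₖ) fₐ + f_{k+1} (fₐ + f_{a-1}).
NormalForm-+fib[k+a] : ∀ {a s} → 2 ≤ a → ∀ k → NormalForm a s → NormalForm a (s + (fib a + fib (k + a)))
NormalForm-+fib[k+a] {a} {s} _ zero t =
  subst (NormalForm a) (+-assoc s (fib a) (fib a)) (NormalForm-+fₐ (NormalForm-+fₐ t))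
NormalForm-+fib[k+a] {suc b} {s} 2≤a (suc k) t =
  subst (NormalForm (suc b)) carry
    (+*-closed {NormalForm (suc b)} F NormalForm-+fₐ (suc (fib k))
      (+*-closed {NormalForm (suc b)} (F + G) (NormalForm-+fib 2≤a ≤-refl) (fib (suc k)) t))
  where
  F G : ℕ
  F = fib (suc b)
  G = fib b
  carry : s + fib (suc k) * (F + G) + suc (fib k) * F ≡ s + (F + fib (suc k + suc b))
  carry = trans (regroup s (fib (suc k)) (fib k) F G)
                (cong (λ t → s + (F + t)) (sym (fib-+ (suc k) b)))
    where
    regroup : ∀ s p q F G → s + p * (F + G) + suc q * F ≡ s + (F + ((p + q) * F + p * G))
    regroup = solve-∀

NormalForm-+generator : ∀ {a s} → 2 ≤ a → ∀ n → NormalForm a s → NormalForm a (s + (fib a + fib n))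
NormalForm-+generator {a} {s} 2≤a n t with n <? a
... | yes n<a = NormalForm-+fib 2≤a n<a t
... | no  n≮a with m≤n⇒∃[o]m+o≡n (≮⇒≥ n≮a)
...   | k , refl =
  subst (λ n → NormalForm a (s + (fib a + fib n))) (+-comm k a) (NormalForm-+fib[k+a] 2≤a k t)

NormalForm-+InS : ∀ {a s y} → 2 ≤ a → NormalForm a s → InS a y → NormalForm a (s + y)
NormalForm-+InS {a} {s} _   t zeroS     = subst (NormalForm a) (sym (+-identityʳ s)) t
NormalForm-+InS         2≤a t (genS n)  = NormalForm-+generator 2≤a n t
NormalForm-+InS {a} {s} 2≤a t (addS {x} {y} x∈S y∈S) =
  subst (NormalForm a) (+-assoc s x y) (NormalForm-+InS 2≤a (NormalForm-+InS 2≤a t x∈S) y∈S)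

InS⇒NormalForm : ∀ {a s} → 2 ≤ a → InS a s → NormalForm a s
InS⇒NormalForm {suc b} 2≤a = NormalForm-+InS 2≤a (normal 0 (fib[1+n]>0 b) z≤n)

InS-sumBelow : ∀ a n P → InS a (countBelow n P * fib a + sumBelow fib n P)
InS-sumBelow a zero    P = zeroS
InS-sumBelow a (suc n) P with P n
... | true  = subst (InS a) (regroup (countBelow n P) (fib a) (sumBelow fib n P) (fib n))
                (addS (InS-sumBelow a n P) (genS n))
  where
  regroup : ∀ c F t f → c * F + t + (F + f) ≡ (c + 1) * F + (t + f)
  regroup = solve-∀
... | false = subst (InS a) (regroup (countBelow n P) (fib a) (sumBelow fib n P)) (InS-sumBelow a n P)
  where
  regroup : ∀ c F t → c * F + t ≡ (c + 0) * F + (t + 0)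
  regroup = solve-∀

InS-multiple : ∀ a j → InS a (j * fib a)
InS-multiple a zero    = zeroS
InS-multiple a (suc j) =
  subst (InS a) (cong (_+ j * fib a) (+-identityʳ (fib a))) (addS (genS 0) (InS-multiple a j))

NormalForm⇒InS : ∀ {a s} → 1 ≤ a → NormalForm a s → InS a s
NormalForm⇒InS {suc b} _ (normal m {x} x< x≤m) with zeckendorf-exists (suc b) x< | m≤n⇒∃[o]m+o≡n x≤m
... | P , zP , refl | d , refl =
  subst (InS (suc b)) carry (addS (InS-sumBelow (suc b) (suc b) P) (InS-multiple (suc b) d))
  where
  F S : ℕ
  F = fib (suc b)
  S = sumBelow fib (suc b) P
  carry : countBelow (suc b) P * F + S + d * F ≡ (summands S + d) * F + S
  carry = trans (cong (λ c → c * F + S + d * F) (countBelow≡summands b zP)) (regroup (summands S) F S d)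
    where
    regroup : ∀ c F S d → c * F + S + d * F ≡ (c + d) * F + S
    regroup = solve-∀

aperyElement : ℕ → ℕ → ℕ
aperyElement a x = summands x * fib a + x

InAp⇒aperyElement : ∀ {a s} → 2 ≤ a → InAp a s → Σ ℕ λ x → x < fib a × s ≡ aperyElement a x
InAp⇒aperyElement {a} 2≤a (s∈S , s-fₐ∉S) with InS⇒NormalForm 2≤a s∈S
... | normal m {x} x< x≤m = x , x< , cong (λ m → m * fib a + x) (≤-antisym m≤x x≤m)
  where
  1≤a : 1 ≤ a
  1≤a = ≤-trans (s≤s z≤n) 2≤a
  lower : ∀ m → summands x < m → Σ ℕ λ t → InS a t × t + fib a ≡ m * fib a + x
  lower (suc m) x<m+1 = m * fib a + x , NormalForm⇒InS 1≤a (normal m x< (s≤s⁻¹ x<m+1)) , shift m (fib a) x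
    where
    shift : ∀ m F x → m * F + x + F ≡ suc m * F + x
    shift = solve-∀
  m≤x : m ≤ summands x
  m≤x = ≮⇒≥ (λ x<m → s-fₐ∉S (lower m x<m))

aperyElement-InAp : ∀ {a x} → 2 ≤ a → x < fib a → InAp a (aperyElement a x)
aperyElement-InAp {a} {x} 2≤a x< =
  NormalForm⇒InS (≤-trans (s≤s z≤n) 2≤a) (normal (summands x) x< ≤-refl) , lower∉S
  where
  shift : ∀ m F y → suc m * F + y ≡ m * F + y + F
  shift = solve-∀
  lower∉S : ¬ (Σ ℕ λ t → InS a t × t + fib a ≡ aperyElement a x)
  lower∉S (t , t∈S , eq) with InS⇒NormalForm 2≤a t∈S
  ... | normal m {y} y< y≤m
        with quot-rem-unique {m = suc m} {summands x} y< x< (trans (shift m (fib a) y) eq)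
  ...   | m+1≡ , refl = 1+n≰n (subst (_≤ m) (sym m+1≡) y≤m)

weight : ∀ {a} → Subset a → ℕ
weight {a} B = ∣ B ∣ * fib a + sumSub fib B

sumSub-fib-< : ∀ {n} (B : Subset (suc n)) → IsZeckendorf (suc n) (indicator B) →
               sumSub fib B < fib (suc n)
sumSub-fib-< {n} B z = subst (_< fib (suc n)) (sym (sumSub≡sumBelow fib B)) (sumBelow-fib-< n z)

weight≡aperyElement : ∀ {n} (B : Subset (suc n)) → IsZeckendorf (suc n) (indicator B) →
                      weight B ≡ aperyElement (suc n) (sumSub fib B)
weight≡aperyElement {n} B z = cong (λ c → c * fib (suc n) + sumSub fib B)
  (trans (∣∣≡countBelow B) (trans (countBelow≡summands n z) (cong summands (sym (sumSub≡sumBelow fib B)))))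

sumSub-⊥ : ∀ f n → sumSub f (⊥ {n}) ≡ 0
sumSub-⊥ f zero    = refl
sumSub-⊥ f (suc n) = sumSub-⊥ (f ∘ suc) n

weight-⊥ : ∀ {n} → weight (⊥ {n}) ≡ 0
weight-⊥ {n} = cong₂ (λ c s → c * fib n + s) (∣⊥∣≡0 n) (sumSub-⊥ fib n)

weight≢0 : ∀ {a} (B : Subset a) → 0 < fib a → B ≢ ⊥ → weight B ≢ 0
weight≢0 {a} B fₐ>0 B≢⊥ w≡0 with m*n≡0⇒m≡0∨n≡0 ∣ B ∣ (m+n≡0⇒m≡0 _ w≡0)
... | inj₁ ∣B∣≡0 = B≢⊥ (∣p∣≡0⇒p≡⊥ B ∣B∣≡0)
... | inj₂ fₐ≡0  = <⇒≢ fₐ>0 (sym fₐ≡0)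

zeckendorf-subset : ∀ {a x} → x < fib a →
                    Σ (Subset a) λ B → IsZeckendorf a (indicator B) × sumSub fib B ≡ x
zeckendorf-subset {a} x< with zeckendorf-exists a x<
... | P , zP , sumP = fromIndicator a P , IsZeckendorf-restrict ≤-refl (indicator-fromIndicator a P) zP ,
  trans (sumSub≡sumBelow fib (fromIndicator a P))
        (trans (sumBelow-cong fib a (indicator-fromIndicator a P)) sumP)

InAp⇒weight : ∀ {a s} → 2 ≤ a → InAp a s × s ≢ 0 →
              Σ (Subset a) λ B → (InF a B × B ≢ ⊥) × s ≡ weight B
InAp⇒weight {suc b} 2≤a (s∈Ap , s≢0) with InAp⇒aperyElement 2≤a s∈Ap
... | x , x< , refl with zeckendorf-subset x<
...   | B , zB , sum≡x = B , (IsZeckendorf⇒InF zB B≢⊥ , B≢⊥) , s≡w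
  where
  s≡w : aperyElement (suc b) x ≡ weight B
  s≡w = sym (trans (weight≡aperyElement B zB) (cong (aperyElement (suc b)) sum≡x))
  B≢⊥ : B ≢ ⊥
  B≢⊥ B≡⊥ = s≢0 (trans s≡w (trans (cong weight B≡⊥) (weight-⊥ {suc b})))

weight⇒InAp : ∀ {a s} → 2 ≤ a → (Σ (Subset a) λ B → (InF a B × B ≢ ⊥) × s ≡ weight B) →
              InAp a s × s ≢ 0
weight⇒InAp {suc b} 2≤a (B , (B∈F , B≢⊥) , refl) =
  subst (InAp (suc b)) (sym (weight≡aperyElement B zB)) (aperyElement-InAp 2≤a (sumSub-fib-< B zB)) ,
  weight≢0 B (fib[1+n]>0 b) B≢⊥
  where
  zB : IsZeckendorf (suc b) (indicator B)
  zB = InF⇒IsZeckendorf B∈F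

weight-injective : ∀ {a} {B₁ B₂ : Subset a} → 1 ≤ a → InF a B₁ → InF a B₂ →
                   weight B₁ ≡ weight B₂ → B₁ ≡ B₂
weight-injective {suc b} {B₁} {B₂} _ B₁∈F B₂∈F eq =
  indicator-injective B₁ B₂ (zeckendorf-unique (suc b) z₁ z₂ sum≡)
  where
  z₁ : IsZeckendorf (suc b) (indicator B₁)
  z₁ = InF⇒IsZeckendorf B₁∈F
  z₂ : IsZeckendorf (suc b) (indicator B₂)
  z₂ = InF⇒IsZeckendorf B₂∈F
  sum≡ : sumBelow fib (suc b) (indicator B₁) ≡ sumBelow fib (suc b) (indicator B₂)
  sum≡ = trans (sym (sumSub≡sumBelow fib B₁))
           (trans (proj₂ (quot-rem-unique {m = ∣ B₁ ∣} {∣ B₂ ∣} (sumSub-fib-< B₁ z₁) (sumSub-fib-< B₂ z₂) eq))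
                  (sumSub≡sumBelow fib B₂))

proposition29 : (a : ℕ) → 3 ≤ a →
    ((s : ℕ) → (InAp a s × s ≢ 0) ⇔
      (Σ (Subset a) λ B → (InF a B × B ≢ ⊥) × s ≡ ∣ B ∣ * fib a + sumSub fib B))
    × ((B₁ B₂ : Subset a) → InF a B₁ × B₁ ≢ ⊥ → InF a B₂ × B₂ ≢ ⊥ →
      (∣ B₁ ∣ * fib a + sumSub fib B₁ ≡ ∣ B₂ ∣ * fib a + sumSub fib B₂) ⇔ (B₁ ≡ B₂))
proposition29 a 3≤a =
  (λ s → mk⇔ (InAp⇒weight 2≤a) (weight⇒InAp 2≤a)) ,
  (λ B₁ B₂ (B₁∈F , _) (B₂∈F , _) → mk⇔ (weight-injective 1≤a B₁∈F B₂∈F) (cong weight))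
  where
  2≤a : 2 ≤ a
  2≤a = ≤-trans (n≤1+n 2) 3≤a
  1≤a : 1 ≤ a
  1≤a = ≤-trans (n≤1+n 1) 2≤a
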